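{- Let $G_1$ be a graph with $\chi(G_1)=k$. Then there exist graphs $G_2$ and $G_3$ such that $G_1$ is an induced subgraph of $G_2$, $G_2$ is an induced subgraph of $G_3$, $\chi(G_2)=k$, $\chi(G_3)=k+1$, and $sn(G_3)=sn(G_2,k+1)$.
   Context: All graphs are finite, simple, undirected and connected. Let $G=(V,E)$ be a graph with chromatic number $\chi(G)$, let $k\ge\chi(G)$ and $S\subseteq V$. A proper $k$-coloring $C_0$ of the induced subgraph $G[S]$ is extendable if it extends to a proper $k$-coloring of $G$, and is a $k$-Sudoku coloring if it extends to exactly one proper $k$-coloring of $G$. The $k$-Sudoku number $sn(G,k)$ is the smallest $|S|$ such that $G[S]$ admits a $k$-Sudoku coloring, and the Sudoku number is $sn(G)=sn(G,\chi(G))$. -}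

module Defs where

open import Data.Nat using (ℕ; suc; _<_; _≤_)
open import Data.Fin using (Fin)
open import Data.Fin.Subset using (Subset; _∈_; ∣_∣)
open import Data.Product using (Σ; _×_; ∃; _,_)
open import Relation.Nullary using (¬_; Dec)
open import Relation.Binary.PropositionalEquality using (_≡_; _≢_)
open import Relation.Binary.Construct.Closure.ReflexiveTransitive using (Star)
open import Function.Definitions using (Injective)

record Graph : Set₁ where
  field
    n        : ℕ
    E        : Fin n → Fin n → Set
    E?       : ∀ u v → Dec (E u v)
    sym      : ∀ {u v} → E u v → E v u
    irrefl   : ∀ {u} → ¬ E u u
    nonempty : 1 ≤ n
    connected : ∀ u v → Star E u v
open Graph public

ProperColoring : (G : Graph) (k : ℕ) → (Fin (n G) → Fin k) → Set
ProperColoring G k c = ∀ u v → E G u v → c u ≢ c v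

Colorable : Graph → ℕ → Set
Colorable G k = Σ (Fin (n G) → Fin k) (ProperColoring G k)

ChromaticNumber : Graph → ℕ → Set
ChromaticNumber G k = Colorable G k × (∀ j → j < k → ¬ Colorable G j)

InducedSubgraph : Graph → Graph → Set
InducedSubgraph G H =
  Σ (Fin (n G) → Fin (n H)) λ f →
    Injective _≡_ _≡_ f ×
    (∀ u v → (E G u v → E H (f u) (f v)) × (E H (f u) (f v) → E G u v))

PartialColoring : (G : Graph) (k : ℕ) (S : Subset (n G)) → Set
PartialColoring G k S = (v : Fin (n G)) → v ∈ S → Fin k

ProperPartial : (G : Graph) (k : ℕ) (S : Subset (n G)) → PartialColoring G k S → Set
ProperPartial G k S c₀ =
  ∀ u v (pu : u ∈ S) (pv : v ∈ S) → E G u v → c₀ u pu ≢ c₀ v pv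

Extends : (G : Graph) (k : ℕ) (S : Subset (n G)) →
          (Fin (n G) → Fin k) → PartialColoring G k S → Set
Extends G k S C c₀ = ∀ v (p : v ∈ S) → C v ≡ c₀ v p

IsSudokuColoring : (G : Graph) (k : ℕ) (S : Subset (n G)) → PartialColoring G k S → Set
IsSudokuColoring G k S c₀ =
  ProperPartial G k S c₀ ×
  (Σ (Fin (n G) → Fin k) λ C →
     ProperColoring G k C × Extends G k S C c₀ ×
     (∀ C′ → ProperColoring G k C′ → Extends G k S C′ c₀ → ∀ v → C′ v ≡ C v))

HasSudokuOfSize : Graph → ℕ → ℕ → Set
HasSudokuOfSize G k m =
  Σ (Subset (n G)) λ S → ∣ S ∣ ≡ m ×
    Σ (PartialColoring G k S) (IsSudokuColoring G k S)

SudokuNumber : Graph → ℕ → ℕ → Set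
SudokuNumber G k m = HasSudokuOfSize G k m × (∀ m′ → m′ < m → ¬ HasSudokuOfSize G k m′)

-- Attach k pendant vertices to every vertex of G₁ (k = χ(G₁) ≥ 2) to obtain G₂, and add
-- to G₂ an apex adjacent exactly to the vertices of G₁ to obtain G₃; then χ(G₂) = k and
-- χ(G₃) = k + 1. With at least three colours a pendant vertex outside a Sudoku set can
-- always be recoloured, so every Sudoku set contains all pendant vertices. Conversely,
-- giving the k pendants of v the k colours other than the colour of v forces the colour
-- of v, and the apex, which then sees k distinct colours, is forced as well. So the
-- pendant vertices form a minimum (k + 1)-Sudoku set of both G₂ and G₃. For k = 1 the
-- graph G₁ is a single vertex; take G₂ = G₁ and G₃ = K₂.
module Submission where

open import Defs
open import Data.Bool using (Bool; true; false)
open import Data.Empty using (⊥; ⊥-elim)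
open import Data.Fin using (Fin; zero; suc; punchIn; punchOut; combine; remQuot; fromℕ<; _≟_)
open import Data.Fin.Permutation.Components using (transpose; transpose-inverse)
open import Data.Fin.Properties
  using (0≢1+n; any?; suc-injective; punchInᵢ≢i; punchIn-injective; punchIn-punchOut; punchOut-injective;
         remQuot-combine; combine-remQuot)
open import Data.Fin.Subset using (Subset; _∈_; _∉_; ∣_∣; inside; outside; ⁅_⁆)
open import Data.Fin.Subset.Properties using (_∈?_; p⊆q⇒∣p∣≤∣q∣; ∣⁅x⁆∣≡1; x∈⁅x⁆)
open import Data.Nat using (ℕ; zero; suc; _+_; _*_; _<_; s≤s; z≤n)
open import Data.Nat.Properties using (≤-refl; ≤-trans; <⇒≱; m≤m*n)
open import Data.Product using (Σ; ∃; _×_; _,_; proj₁; proj₂; uncurry)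
open import Data.Unit using (⊤; tt)
open import Data.Vec using (_∷_; tabulate; there)
open import Data.Vec.Functional using (updateAt)
open import Data.Vec.Functional.Properties using (updateAt-updates; updateAt-minimal)
open import Data.Vec.Properties using (lookup∘tabulate; []=⇒lookup; lookup⇒[]=)
open import Function using (_∘_; id; const)
open import Relation.Binary.Construct.Closure.ReflexiveTransitive using (Star; ε; _◅_; _◅◅_; gmap)
open import Relation.Binary.PropositionalEquality as ≡
  using (_≡_; _≢_; refl; cong; subst₂; module ≡-Reasoning)
open import Relation.Nullary using (¬_; Dec; yes; no)
open import Relation.Nullary.Decidable using (dec-true)
open import Relation.Unary using (Decidable)

Homomorphism : (G H : Graph) → (Fin (n G) → Fin (n H)) → Set
Homomorphism G H f = ∀ u v → E G u v → E H (f u) (f v)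

Pendant : (G : Graph) → Fin (n G) → Set
Pendant G x = ∃ λ p → ∀ w → E G x w → w ≡ p

Forces : (G : Graph) (k : ℕ) → Subset (n G) → (Fin (n G) → Fin k) → Set
Forces G k S C =
  ∀ C′ → ProperColoring G k C′ → Extends G k S C′ (λ v _ → C v) → ∀ v → C′ v ≡ C v

induced-refl : ∀ G → InducedSubgraph G G
induced-refl G = id , id , λ _ _ → id , id

induced⇒homomorphism : ∀ G H (ι : InducedSubgraph G H) → Homomorphism G H (proj₁ ι)
induced⇒homomorphism _ _ (_ , _ , adjacency) u v = proj₁ (adjacency u v)

¬colorable-0 : ∀ G → ¬ Colorable G 0
¬colorable-0 G (c , _) with c (fromℕ< (nonempty G))
... | ()

colorable-omitting : ∀ G {k} (c : Fin (n G) → Fin (suc k)) → ProperColoring G (suc k) c →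
                     ∀ a → (∀ v → a ≢ c v) → Colorable G k
colorable-omitting G c proper a a∉c =
  (λ v → punchOut (a∉c v)) ,
  λ u v e eq → proper u v e (punchOut-injective (a∉c u) (a∉c v) eq)

module _ (G H : Graph) {f : Fin (n G) → Fin (n H)} (hom : Homomorphism G H f) where

  colorable-pullback : ∀ {k} → Colorable H k → Colorable G k
  colorable-pullback (c , proper) = c ∘ f , λ u v e → proper (f u) (f v) (hom u v e)

  chromaticNumber-via-homomorphism : ∀ {k} → ChromaticNumber G k → Colorable H k →
                                     ChromaticNumber H k
  chromaticNumber-via-homomorphism (_ , optimal) colorable =
    colorable , λ j j<k colorableH → optimal j j<k (colorable-pullback colorableH)

optimalColoring-surjective : ∀ G {k} → ChromaticNumber G (suc k) →
                             ∀ c → ProperColoring G (suc k) c → ∀ a → ∃ λ v → c v ≡ a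
optimalColoring-surjective G (_ , optimal) c proper a with any? (λ v → c v ≟ a)
... | yes hit = hit
... | no miss =
  ⊥-elim (optimal _ ≤-refl (colorable-omitting G c proper a (λ v a≡cv → miss (v , ≡.sym a≡cv))))

colorable-1⇒trivial : ∀ G → Colorable G 1 → ∀ u v → u ≡ v
colorable-1⇒trivial G (c , proper) u v = edgeless (connected G u v)
  where
  one-color : (a b : Fin 1) → a ≡ b
  one-color zero zero = refl

  edgeless : ∀ {u v} → Star (E G) u v → u ≡ v
  edgeless ε = refl
  edgeless {u} (_◅_ {j = w} e _) = ⊥-elim (proper u w e (one-color (c u) (c w)))

forces⇒hasSudokuOfSize : ∀ G {k S C} → ProperColoring G k C → Forces G k S C →
                         HasSudokuOfSize G k ∣ S ∣
forces⇒hasSudokuOfSize _ {S = S} proper forces =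
  S , refl , _ , (λ u v _ _ → proper u v) , _ , proper , (λ _ _ → refl) , forces

avoid-two : ∀ {k} (a b : Fin (3 + k)) → ∃ λ c → c ≢ a × c ≢ b
avoid-two {k} a b with a ≟ b
... | yes refl = punchIn a zero , punchInᵢ≢i a zero , punchInᵢ≢i a zero
... | no a≢b = punchIn a j , punchInᵢ≢i a j , c≢b
  where
  b′ : Fin (2 + k)
  b′ = punchOut a≢b

  j : Fin (2 + k)
  j = punchIn b′ zero

  c≢b : punchIn a j ≢ b
  c≢b c≡b = punchInᵢ≢i b′ zero
    (punchIn-injective a j b′ (≡.trans c≡b (≡.sym (punchIn-punchOut a≢b))))

pendant∈sudokuSet : ∀ G {k S c₀ x} → Pendant G x → IsSudokuColoring G (3 + k) S c₀ → x ∈ S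
pendant∈sudokuSet G {k} {S} {x = x} (p , only-p) (_ , C , proper , extends , unique)
  with x ∈? S | avoid-two (C x) (C p)
... | yes x∈S | _ = x∈S
... | no x∉S  | c , c≢Cx , c≢Cp =
  ⊥-elim (c≢Cx (≡.trans (≡.sym (updateAt-updates x C)) (unique C′ proper′ extends′ x)))
  where
  open ≡-Reasoning

  C′ : Fin (n G) → Fin (3 + k)
  C′ = updateAt C x (const c)

  elsewhere : ∀ v → v ≢ x → C′ v ≡ C v
  elsewhere v v≢x = updateAt-minimal v x C v≢x

  x-vs-neighbour : ∀ v → E G x v → C′ x ≢ C′ v
  x-vs-neighbour v e eq = c≢Cp (begin
    c     ≡⟨ ≡.sym (updateAt-updates x C) ⟩
    C′ x  ≡⟨ eq ⟩
    C′ v  ≡⟨ elsewhere v (λ { refl → irrefl G e }) ⟩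
    C v   ≡⟨ cong C (only-p v e) ⟩
    C p   ∎)

  proper′ : ProperColoring G (3 + k) C′
  proper′ u v e with u ≟ x | v ≟ x
  ... | yes refl | _        = x-vs-neighbour v e
  ... | no _     | yes refl = x-vs-neighbour u (sym G e) ∘ ≡.sym
  ... | no u≢x   | no v≢x   =
    subst₂ _≢_ (≡.sym (elsewhere u u≢x)) (≡.sym (elsewhere v v≢x)) (proper u v e)

  extends′ : Extends G (3 + k) S C′ _
  extends′ v v∈S = ≡.trans (elsewhere v (λ { refl → x∉S v∈S })) (extends v v∈S)

sudokuNumber-pendants : ∀ G {k L C} → (∀ x → x ∈ L → Pendant G x) →
                        ProperColoring G (3 + k) C → Forces G (3 + k) L C →
                        SudokuNumber G (3 + k) ∣ L ∣
sudokuNumber-pendants G {k} {L} pendant proper forces =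
  forces⇒hasSudokuOfSize G proper forces , minimal
  where
  minimal : ∀ m → m < ∣ L ∣ → ¬ HasSudokuOfSize G (3 + k) m
  minimal m m<∣L∣ (S , refl , _ , sudoku) =
    <⇒≱ m<∣L∣ (p⊆q⇒∣p∣≤∣q∣ (λ {x} x∈L → pendant∈sudokuSet G (pendant x x∈L) sudoku))

∣p∣≡0⇒x∉p : ∀ {m} {p : Subset m} {x} → ∣ p ∣ ≡ 0 → x ∉ p
∣p∣≡0⇒x∉p {p = inside ∷ _} ()
∣p∣≡0⇒x∉p {p = outside ∷ p} ∣p∣≡0 (there x∈p) = ∣p∣≡0⇒x∉p {p = p} ∣p∣≡0 x∈p

transpose-injective : ∀ {m} (a b : Fin m) {x y} → transpose a b x ≡ transpose a b y → x ≡ y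
transpose-injective a b {x} {y} eq = begin
  x                               ≡⟨ transpose-inverse b a ⟨
  transpose b a (transpose a b x) ≡⟨ cong (transpose b a) eq ⟩
  transpose b a (transpose a b y) ≡⟨ transpose-inverse b a ⟩
  y                               ∎
  where open ≡-Reasoning

transpose-swaps : ∀ {m} (a b : Fin m) → transpose a b a ≡ b
transpose-swaps a b rewrite dec-true (a ≟ a) refl = refl

¬hasSudokuOfSize-0 : ∀ G k → ¬ HasSudokuOfSize G (2 + k) 0
¬hasSudokuOfSize-0 G k (S , ∣S∣≡0 , _ , _ , C , proper , _ , unique) =
  punchInᵢ≢i a zero (≡.trans (≡.sym (transpose-swaps a b)) swapped-agrees)
  where
  v₀ : Fin (n G)
  v₀ = fromℕ< (nonempty G)

  a b : Fin (2 + k)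
  a = C v₀
  b = punchIn a zero

  swapped-proper : ProperColoring G (2 + k) (transpose a b ∘ C)
  swapped-proper u v e = proper u v e ∘ transpose-injective a b

  swapped-agrees : transpose a b a ≡ a
  swapped-agrees =
    unique (transpose a b ∘ C) swapped-proper (λ v v∈S → ⊥-elim (∣p∣≡0⇒x∉p ∣S∣≡0 v∈S)) v₀

sudokuNumber-1 : ∀ G {k} → HasSudokuOfSize G (2 + k) 1 → SudokuNumber G (2 + k) 1
sudokuNumber-1 G {k} sudoku = sudoku , λ { zero _ → ¬hasSudokuOfSize-0 G k ; (suc _) (s≤s ()) }

module Cone (G : Graph) {P : Fin (n G) → Set} (P? : Decidable P) {p₀ : Fin (n G)} (Pp₀ : P p₀) where

  Adj : Fin (suc (n G)) → Fin (suc (n G)) → Set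
  Adj zero    zero    = ⊥
  Adj zero    (suc v) = P v
  Adj (suc u) zero    = P u
  Adj (suc u) (suc v) = E G u v

  adj? : ∀ x y → Dec (Adj x y)
  adj? zero    zero    = no id
  adj? zero    (suc v) = P? v
  adj? (suc u) zero    = P? u
  adj? (suc u) (suc v) = E? G u v

  adj-sym : ∀ {x y} → Adj x y → Adj y x
  adj-sym {zero}  {suc _} = id
  adj-sym {suc _} {zero}  = id
  adj-sym {suc _} {suc _} = sym G

  adj-irrefl : ∀ {x} → ¬ Adj x x
  adj-irrefl {zero}  = id
  adj-irrefl {suc _} = irrefl G

  to-apex : ∀ x → Star Adj x zero
  to-apex zero    = ε
  to-apex (suc u) = gmap suc id (connected G u p₀) ◅◅ (Pp₀ ◅ ε)

  from-apex : ∀ y → Star Adj zero y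
  from-apex zero    = ε
  from-apex (suc v) = Pp₀ ◅ gmap suc id (connected G p₀ v)

  cone : Graph
  cone = record
    { n         = suc (n G)
    ; E         = Adj
    ; E?        = adj?
    ; sym       = λ {x} {y} → adj-sym {x} {y}
    ; irrefl    = λ {x} → adj-irrefl {x}
    ; nonempty  = s≤s z≤n
    ; connected = λ x y → to-apex x ◅◅ from-apex y
    }

  cone-induced : InducedSubgraph G cone
  cone-induced = suc , suc-injective , λ _ _ → id , id

  withApex : ∀ {k} → (Fin (n G) → Fin (suc k)) → Fin (suc (n G)) → Fin (suc k)
  withApex C zero    = zero
  withApex C (suc v) = C v

  withApex-proper : ∀ {k C} → ProperColoring G (suc k) C → (∀ v → P v → C v ≢ zero) →
                    ProperColoring cone (suc k) (withApex C)
  withApex-proper proper avoids zero    (suc v) Pv = avoids v Pv ∘ ≡.sym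
  withApex-proper proper avoids (suc u) zero    Pu = avoids u Pu
  withApex-proper proper avoids (suc u) (suc v) e  = proper u v e

  withApex-forces : ∀ {k S C} → (∀ a → ∃ λ v → P v × C v ≡ suc a) → Forces G (suc k) S C →
                    Forces cone (suc k) (outside ∷ S) (withApex C)
  withApex-forces {C = C} covers forces C′ proper′ extends′ = forced
    where
    on-G : ∀ v → C′ (suc v) ≡ C v
    on-G = forces (C′ ∘ suc) (λ u v → proper′ (suc u) (suc v))
                  (λ v v∈S → extends′ (suc v) (there v∈S))

    apex≢suc : ∀ a → C′ zero ≢ suc a
    apex≢suc a eq with covers a
    ... | v , Pv , Cv≡a = proper′ zero (suc v) Pv (≡.trans eq (≡.sym (≡.trans (on-G v) Cv≡a)))

    zero-if-not-suc : ∀ {m} (x : Fin (suc m)) → (∀ a → x ≢ suc a) → x ≡ zero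
    zero-if-not-suc zero    _   = refl
    zero-if-not-suc (suc a) x≢a = ⊥-elim (x≢a a refl)

    forced : ∀ x → C′ x ≡ withApex C x
    forced zero    = zero-if-not-suc (C′ zero) apex≢suc
    forced (suc v) = on-G v

  chromaticNumber-cone : ∀ G₁ {k g} → ChromaticNumber G₁ k → Homomorphism G₁ G g →
                         (∀ v → P (g v)) → Colorable cone (suc k) → ChromaticNumber cone (suc k)
  chromaticNumber-cone G₁ {k} {g} (_ , optimal) hom Pg colorable = colorable , lower
    where
    lower : ∀ j → j < suc k → ¬ Colorable cone j
    lower zero    _         = ¬colorable-0 cone
    lower (suc j) (s≤s j<k) (d , proper) =
      optimal j j<k (colorable-omitting G₁ (d ∘ suc ∘ g) (λ u v e → proper _ _ (hom u v e))
                                        (d zero) (λ v → proper zero (suc (g v)) (Pg v)))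

  pendant-suc : ∀ {x} → Pendant G x → ¬ P x → Pendant cone (suc x)
  pendant-suc (p , only-p) ¬Px =
    suc p , λ { zero Px → ⊥-elim (¬Px Px) ; (suc w) e → cong suc (only-p w e) }

  pendants-outside∷ : ∀ {S} → (∀ x → x ∈ S → Pendant G x × ¬ P x) →
                      ∀ x → x ∈ outside ∷ S → Pendant cone x
  pendants-outside∷ pendant (suc x) (there x∈S) = uncurry pendant-suc (pendant x x∈S)

-- Vertex (v , zero) is v itself and (v , suc j) is the j-th pendant vertex attached to v;
-- the vertex set is encoded as Fin (n G * suc ℓ) through combine/remQuot.
module Pendants (G : Graph) (ℓ : ℕ) where

  Vertex : Set
  Vertex = Fin (n G) × Fin (suc ℓ)

  core : Fin (n G) → Vertex
  core v = v , zero

  Adj : Vertex → Vertex → Set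
  Adj (u , zero)  (v , zero)  = E G u v
  Adj (u , zero)  (v , suc _) = u ≡ v
  Adj (u , suc _) (v , zero)  = u ≡ v
  Adj (_ , suc _) (_ , suc _) = ⊥

  adj? : ∀ x y → Dec (Adj x y)
  adj? (u , zero)  (v , zero)  = E? G u v
  adj? (u , zero)  (v , suc _) = u ≟ v
  adj? (u , suc _) (v , zero)  = u ≟ v
  adj? (_ , suc _) (_ , suc _) = no id

  adj-sym : ∀ x y → Adj x y → Adj y x
  adj-sym (_ , zero)  (_ , zero)  = sym G
  adj-sym (_ , zero)  (_ , suc _) = ≡.sym
  adj-sym (_ , suc _) (_ , zero)  = ≡.sym

  adj-irrefl : ∀ x → ¬ Adj x x
  adj-irrefl (_ , zero) = irrefl G

  to-core : ∀ x → Star Adj x (core (proj₁ x))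
  to-core (_ , zero)  = ε
  to-core (_ , suc _) = refl ◅ ε

  from-core : ∀ x → Star Adj (core (proj₁ x)) x
  from-core (_ , zero)  = ε
  from-core (_ , suc _) = refl ◅ ε

  adj-connected : ∀ x y → Star Adj x y
  adj-connected x y = to-core x ◅◅ gmap core id (connected G _ _) ◅◅ from-core y

  index : Vertex → Fin (n G * suc ℓ)
  index = uncurry combine

  vertex : Fin (n G * suc ℓ) → Vertex
  vertex = remQuot (suc ℓ)

  vertex-index : ∀ x → vertex (index x) ≡ x
  vertex-index (v , a) = remQuot-combine v a

  index-vertex : ∀ i → index (vertex i) ≡ i
  index-vertex = combine-remQuot {n G} (suc ℓ)

  adj⇒edge : ∀ {x y} → Adj x y → Adj (vertex (index x)) (vertex (index y))
  adj⇒edge {x} {y} = subst₂ Adj (≡.sym (vertex-index x)) (≡.sym (vertex-index y))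

  edge⇒adj : ∀ {x y} → Adj (vertex (index x)) (vertex (index y)) → Adj x y
  edge⇒adj {x} {y} = subst₂ Adj (vertex-index x) (vertex-index y)

  withPendants : Graph
  withPendants = record
    { n         = n G * suc ℓ
    ; E         = λ i j → Adj (vertex i) (vertex j)
    ; E?        = λ i j → adj? (vertex i) (vertex j)
    ; sym       = λ {i} {j} → adj-sym (vertex i) (vertex j)
    ; irrefl    = λ {i} → adj-irrefl (vertex i)
    ; nonempty  = ≤-trans (nonempty G) (m≤m*n (n G) (suc ℓ))
    ; connected = λ i j → subst₂ (Star _) (index-vertex i) (index-vertex j)
                            (gmap index adj⇒edge (adj-connected (vertex i) (vertex j)))
    }

  core-embedding : InducedSubgraph G withPendants
  core-embedding = index ∘ core , core-injective , λ _ _ → adj⇒edge , edge⇒adj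
    where
    core-injective : ∀ {u v} → index (core u) ≡ index (core v) → u ≡ v
    core-injective {u} {v} eq = begin
      u                               ≡⟨ cong proj₁ (vertex-index (core u)) ⟨
      proj₁ (vertex (index (core u))) ≡⟨ cong (proj₁ ∘ vertex) eq ⟩
      proj₁ (vertex (index (core v))) ≡⟨ cong proj₁ (vertex-index (core v)) ⟩
      v                               ∎
      where open ≡-Reasoning

  IsCore : Fin (n G * suc ℓ) → Set
  IsCore i = proj₂ (vertex i) ≡ zero

  isCore? : Decidable IsCore
  isCore? i = proj₂ (vertex i) ≟ zero

  core-isCore : ∀ v → IsCore (index (core v))
  core-isCore v = cong proj₂ (vertex-index (core v))

  isLeaf : Fin (suc ℓ) → Bool
  isLeaf zero    = false
  isLeaf (suc _) = true

  leaves : Subset (n G * suc ℓ)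
  leaves = tabulate (isLeaf ∘ proj₂ ∘ vertex)

  leaf∈leaves : ∀ v j → index (v , suc j) ∈ leaves
  leaf∈leaves v j = lookup⇒[]= _ leaves (≡.trans (lookup∘tabulate _ (index (v , suc j)))
                                                (cong (isLeaf ∘ proj₂) (vertex-index (v , suc j))))

  adj-from-leaf : ∀ x y → isLeaf (proj₂ x) ≡ true → Adj x y → y ≡ core (proj₁ x)
  adj-from-leaf (_ , suc _) (_ , zero) _ refl = refl

  leaves-pendant : ∀ i → i ∈ leaves → Pendant withPendants i × ¬ IsCore i
  leaves-pendant i i∈leaves = (index (core (proj₁ (vertex i))) , only-core) , not-core
    where
    leaf : isLeaf (proj₂ (vertex i)) ≡ true
    leaf = ≡.trans (≡.sym (lookup∘tabulate _ i)) ([]=⇒lookup i∈leaves)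

    only-core : ∀ w → Adj (vertex i) (vertex w) → w ≡ index (core (proj₁ (vertex i)))
    only-core w e = ≡.trans (≡.sym (index-vertex w)) (cong index (adj-from-leaf _ _ leaf e))

    not-core : ¬ IsCore i
    not-core isCore with ≡.trans (≡.sym (cong isLeaf isCore)) leaf
    ... | ()

  colorVertex : ∀ {m} → (Fin (n G) → Fin m) → (Fin (n G) → Fin ℓ → Fin m) → Vertex → Fin m
  colorVertex c leafColor (v , zero)  = c v
  colorVertex c leafColor (v , suc j) = leafColor v j

  pendantColoring : ∀ {m} → (Fin (n G) → Fin m) → (Fin (n G) → Fin ℓ → Fin m) →
                    Fin (n G * suc ℓ) → Fin m
  pendantColoring c leafColor = colorVertex c leafColor ∘ vertex

  pendantColoring-index : ∀ {m} {c : Fin (n G) → Fin m} {leafColor} x →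
                          pendantColoring c leafColor (index x) ≡ colorVertex c leafColor x
  pendantColoring-index x = cong (colorVertex _ _) (vertex-index x)

  pendantColoring-core : ∀ {m} {c : Fin (n G) → Fin m} {leafColor} i → IsCore i →
                         pendantColoring c leafColor i ≡ c (proj₁ (vertex i))
  pendantColoring-core {c = c} {leafColor} i = colorVertex-core (vertex i)
    where
    colorVertex-core : ∀ x → proj₂ x ≡ zero → colorVertex c leafColor x ≡ c (proj₁ x)
    colorVertex-core (_ , zero) _ = refl

  pendantColoring-proper : ∀ {m c leafColor} → ProperColoring G m c →
                           (∀ v j → leafColor v j ≢ c v) →
                           ProperColoring withPendants m (pendantColoring c leafColor)
  pendantColoring-proper {c = c} {leafColor} proper leaf≢core i j = proper′ (vertex i) (vertex j)
    where
    proper′ : ∀ x y → Adj x y → colorVertex c leafColor x ≢ colorVertex c leafColor y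
    proper′ (u , zero)  (v , zero)  e    = proper u v e
    proper′ (u , zero)  (_ , suc j) refl = leaf≢core u j ∘ ≡.sym
    proper′ (u , suc j) (_ , zero)  refl = leaf≢core u j

  withPendants-colorable : ∀ {k} → Colorable G (2 + k) → Colorable withPendants (2 + k)
  withPendants-colorable (c , proper) =
    pendantColoring c (λ v _ → punchIn (c v) zero) ,
    pendantColoring-proper proper (λ v _ → punchInᵢ≢i (c v) zero)

  pendantColoring-forces : ∀ c → Forces withPendants (suc ℓ) leaves (pendantColoring c (punchIn ∘ c))
  pendantColoring-forces c C′ proper′ agrees i =
    ≡.trans (cong C′ (≡.sym (index-vertex i))) (forced (vertex i))
    where
    forced : ∀ x → C′ (index x) ≡ colorVertex c (punchIn ∘ c) x
    forced (v , suc j) = ≡.trans (agrees _ (leaf∈leaves v j)) (pendantColoring-index (v , suc j))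
    forced (v , zero) with c v ≟ C′ (index (core v))
    ... | yes eq = ≡.sym eq
    ... | no cv≢ = ⊥-elim (proper′ (index (core v)) (index leaf) (adj⇒edge refl) (≡.sym leaf-color))
      where
      leaf : Vertex
      leaf = v , suc (punchOut cv≢)

      leaf-color : C′ (index leaf) ≡ C′ (index (core v))
      leaf-color = ≡.trans (forced leaf) (punchIn-punchOut cv≢)

SudokuTower : Graph → ℕ → Set₁
SudokuTower G₁ k =
  Σ Graph λ G₂ → Σ Graph λ G₃ →
    InducedSubgraph G₁ G₂ × InducedSubgraph G₂ G₃ ×
    ChromaticNumber G₂ k × ChromaticNumber G₃ (suc k) ×
    Σ ℕ λ m → SudokuNumber G₃ (suc k) m × SudokuNumber G₂ (suc k) m

singleVertex-tower : ∀ G₁ → ChromaticNumber G₁ 1 → SudokuTower G₁ 1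
singleVertex-tower G₁ χ₁ =
  G₁ , cone , induced-refl G₁ , cone-induced ,
  χ₁ , chromaticNumber-cone G₁ χ₁ (λ _ _ → id) (const tt) (withApex C , proper₃) ,
  1 ,
  sudokuNumber-1 cone (≡.subst (HasSudokuOfSize cone 2) (∣⁅x⁆∣≡1 v₀)
                                (forces⇒hasSudokuOfSize cone proper₃ forces₃)) ,
  sudokuNumber-1 G₁ (≡.subst (HasSudokuOfSize G₁ 2) (∣⁅x⁆∣≡1 v₀)
                             (forces⇒hasSudokuOfSize G₁ proper forces))
  where
  v₀ : Fin (n G₁)
  v₀ = fromℕ< (nonempty G₁)

  open Cone G₁ {P = λ _ → ⊤} (λ _ → yes tt) {v₀} tt

  C : Fin (n G₁) → Fin 2
  C _ = suc zero

  proper : ProperColoring G₁ 2 C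
  proper u v e _ = irrefl G₁ (≡.subst (E G₁ u) (colorable-1⇒trivial G₁ (proj₁ χ₁) v u) e)

  forces : Forces G₁ 2 ⁅ v₀ ⁆ C
  forces C′ _ agrees v =
    ≡.trans (cong C′ (colorable-1⇒trivial G₁ (proj₁ χ₁) v v₀)) (agrees v₀ (x∈⁅x⁆ v₀))

  proper₃ : ProperColoring cone 2 (withApex C)
  proper₃ = withApex-proper proper (λ _ _ ())

  forces₃ : Forces cone 2 (outside ∷ ⁅ v₀ ⁆) (withApex C)
  forces₃ = withApex-forces (λ { zero → v₀ , tt , refl }) forces

pendantCone-tower : ∀ G₁ k → ChromaticNumber G₁ (2 + k) → SudokuTower G₁ (2 + k)
pendantCone-tower G₁ k χ₁@((c₁ , proper₁) , _) =
  withPendants , cone , core-embedding , cone-induced ,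
  chromaticNumber-via-homomorphism G₁ withPendants core-hom χ₁
    (withPendants-colorable (c₁ , proper₁)) ,
  chromaticNumber-cone G₁ χ₁ core-hom core-isCore (withApex C₂ , proper₃) ,
  ∣ leaves ∣ ,
  sudokuNumber-pendants cone (pendants-outside∷ leaves-pendant) proper₃ forces₃ ,
  sudokuNumber-pendants withPendants (λ i → proj₁ ∘ leaves-pendant i) proper₂ forces₂
  where
  open Pendants G₁ (2 + k)
  open Cone withPendants isCore? (core-isCore (fromℕ< (nonempty G₁)))

  core-hom : Homomorphism G₁ withPendants (index ∘ core)
  core-hom = induced⇒homomorphism G₁ withPendants core-embedding

  -- Colour zero is kept free for the apex.
  C₂ : Fin (n withPendants) → Fin (3 + k)
  C₂ = pendantColoring (suc ∘ c₁) (punchIn ∘ suc ∘ c₁)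

  proper₂ : ProperColoring withPendants (3 + k) C₂
  proper₂ = pendantColoring-proper (λ u v e → proper₁ u v e ∘ suc-injective)
                                   (λ v → punchInᵢ≢i (suc (c₁ v)))

  forces₂ : Forces withPendants (3 + k) leaves C₂
  forces₂ = pendantColoring-forces (suc ∘ c₁)

  proper₃ : ProperColoring cone (3 + k) (withApex C₂)
  proper₃ = withApex-proper proper₂ λ i isCore C₂i≡0 →
    0≢1+n (≡.trans (≡.sym C₂i≡0) (pendantColoring-core i isCore))

  covers : ∀ a → ∃ λ i → IsCore i × C₂ i ≡ suc a
  covers a with optimalColoring-surjective G₁ χ₁ c₁ proper₁ a
  ... | v , c₁v≡a = index (core v) , core-isCore v ,
                    ≡.trans (pendantColoring-index (core v)) (cong suc c₁v≡a)

  forces₃ : Forces cone (3 + k) (outside ∷ leaves) (withApex C₂)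
  forces₃ = withApex-forces covers forces₂

mainTheorem10 : (G₁ : Graph) (k : ℕ) → ChromaticNumber G₁ k →
    Σ Graph λ G₂ → Σ Graph λ G₃ →
      InducedSubgraph G₁ G₂ × InducedSubgraph G₂ G₃ ×
      ChromaticNumber G₂ k × ChromaticNumber G₃ (suc k) ×
      Σ ℕ λ m → SudokuNumber G₃ (suc k) m × SudokuNumber G₂ (suc k) m
mainTheorem10 G₁ zero          χ₁ = ⊥-elim (¬colorable-0 G₁ (proj₁ χ₁))
mainTheorem10 G₁ (suc zero)    χ₁ = singleVertex-tower G₁ χ₁
mainTheorem10 G₁ (suc (suc k)) χ₁ = pendantCone-tower G₁ k χ₁
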